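{- Let $d\ge2$ be an integer, let $s_d(n)$ be the sum of the base-$d$ digits of $n$, and let $t_d(n)=\overline{(s_d(n))}_d$. For $j\in\{0,\ldots,d-1\}$ let $(a_{j,d}(n))_{n\ge0}$ be the increasing enumeration (indexed from $0$) of the nonnegative integers $k$ with $t_d(k)=j$. Then for all $n\ge0$, $$a_{j,d}(n)=dn+\overline{(j-t_d(n))}_d = dn+\begin{cases} j-t_d(n) & \text{if } 0\le t_d(n)\le j,\\ d+j-t_d(n) & \text{if } j+1\le t_d(n)\le d-1\end{cases} \;=\; dn+d-1-t_d(dn+d-j-1).$$
   Context: For an integer $x$, $\overline{(x)}_d$ denotes the residue of $x$ modulo $d$, i.e. the unique integer in $[0,d-1]$ congruent to $x$ modulo $d$. -}

module Defs where

open import Data.Nat using (ℕ; zero; suc; _+_; _*_; _∸_; _<_; NonZero)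
open import Data.Nat.DivMod using (_/_; _%_)
open import Data.Integer using (ℤ; +_; _-_; _%ℕ_)
open import Relation.Binary.PropositionalEquality using (_≡_)
open import Relation.Nullary using (does)
open import Data.Product using (_×_)
import Data.Nat as ℕ

residue : (d : ℕ) .{{_ : NonZero d}} → ℤ → ℕ
residue d x = x %ℕ d

-- base-d digit sum, computed with fuel; with fuel ≥ n (and d ≥ 2) it is exact,
-- since each step strictly decreases a positive argument.
digitSumFuel : (d : ℕ) .{{_ : NonZero d}} → ℕ → ℕ → ℕ
digitSumFuel d zero    n = 0
digitSumFuel d (suc f) zero = 0
digitSumFuel d (suc f) n@(suc _) = n % d + digitSumFuel d f (n / d)

s : (d : ℕ) .{{_ : NonZero d}} → ℕ → ℕ
s d n = digitSumFuel d n n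

t : (d : ℕ) .{{_ : NonZero d}} → ℕ → ℕ
t d n = residue d (+ (s d n))

countBelow : (d : ℕ) .{{_ : NonZero d}} → ℕ → ℕ → ℕ
countBelow d j zero    = 0
countBelow d j (suc m) = (if does (t d m ℕ.≟ j) then 1 else 0) + countBelow d j m
  where open import Data.Bool using (if_then_else_)

-- "k = a_{j,d}(n)": k is the n-th (indexed from 0) element, in increasing order,
-- of the set { k ≥ 0 | t_d(k) = j }.
IsEnum : (d : ℕ) .{{_ : NonZero d}} → (j n k : ℕ) → Set
IsEnum d j n k = (t d k ≡ j) × (countBelow d j k ≡ n)

{-# OPTIONS --safe #-}
module Submission where

-- Writing m = d * n + r with r < d, the base-d digits of m are those of n followed by r, so
-- s_d(m) = r + s_d(n) and t_d(m) ≡ r + t_d(n) (mod d). Hence every block {dn, …, dn + d - 1}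
-- contains exactly one k with t_d(k) = j, namely k = dn + ρ with ρ the residue of j - t_d(n);
-- counting block by block, it is the n-th such k. The last formula holds because ρ and
-- t_d(dn + d - 1 - j) are residues whose sum is ≡ d - 1 (mod d).

open import Defs
open import Data.Nat using (ℕ; zero; suc; _+_; _*_; _∸_; _≤_; _<_; NonZero; z<s; s≤s; s≤s⁻¹; _%_; _/_)
import Data.Nat as ℕ
open import Data.Nat.Properties
open import Data.Nat.DivMod
open import Data.Nat.Divisibility using (n∣m*n)
open import Data.Integer using (+_; -[1+_]; _-_; _⊖_; _%ℕ_)
open import Data.Integer.Properties using ([+m]-[+n]≡m⊖n; ⊖-≥; +-cancelˡ-⊖)
open import Data.Integer.DivMod using (n%ℕd<d)
open import Data.Bool using (if_then_else_)
open import Data.Product using (_×_; _,_)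
open import Data.Sum using (inj₁; inj₂)
open import Relation.Nullary using (¬_)
open import Relation.Nullary.Decidable using (dec-true; dec-false)
open import Relation.Binary.PropositionalEquality
  using (_≡_; refl; sym; trans; cong; cong₂; subst; module ≡-Reasoning)

open ≡-Reasoning

module _ {d : ℕ} .{{_ : NonZero d}} where

  [m%d+n]%d≡[m+n]%d : ∀ m n → (m % d + n) % d ≡ (m + n) % d
  [m%d+n]%d≡[m+n]%d m n = begin
    (m % d + n) % d           ≡⟨ %-distribˡ-+ (m % d) n d ⟩
    (m % d % d + n % d) % d   ≡⟨ cong (λ x → (x + n % d) % d) (m%n%n≡m%n m d) ⟩
    (m % d + n % d) % d       ≡⟨ %-distribˡ-+ m n d ⟨
    (m + n) % d               ∎

  %-+-cancelʳ : ∀ {x y} k → k ≤ d → (x + k) % d ≡ (y + k) % d → x % d ≡ y % d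
  %-+-cancelʳ {x} {y} k k≤d eq =
    trans (undo x) (trans (cong (λ z → (z + (d ∸ k)) % d) eq) (sym (undo y)))
    where
    undo : ∀ x → x % d ≡ ((x + k) % d + (d ∸ k)) % d
    undo x = begin
      x % d                        ≡⟨ [m+n]%n≡m%n x d ⟨
      (x + d) % d                  ≡⟨ cong (λ z → (x + z) % d) (m+[n∸m]≡n k≤d) ⟨
      (x + (k + (d ∸ k))) % d      ≡⟨ cong (_% d) (+-assoc x k (d ∸ k)) ⟨
      (x + k + (d ∸ k)) % d        ≡⟨ [m%d+n]%d≡[m+n]%d (x + k) (d ∸ k) ⟨
      ((x + k) % d + (d ∸ k)) % d  ∎

  [d*n+r]%d≡r : ∀ n {r} → r < d → (d * n + r) % d ≡ r
  [d*n+r]%d≡r n {r} r<d = begin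
    (d * n + r) % d  ≡⟨ cong (_% d) (trans (+-comm (d * n) r) (cong (_+_ r) (*-comm d n))) ⟩
    (r + n * d) % d  ≡⟨ [m+kn]%n≡m%n r n d ⟩
    r % d            ≡⟨ m<n⇒m%n≡m r<d ⟩
    r                ∎

  [d*n+r]/d≡n : ∀ n {r} → r < d → (d * n + r) / d ≡ n
  [d*n+r]/d≡n n {r} r<d = begin
    (d * n + r) / d    ≡⟨ /-congˡ (trans (+-comm (d * n) r) (cong (_+_ r) (*-comm d n))) ⟩
    (r + n * d) / d    ≡⟨ +-distrib-/-∣ʳ r (n∣m*n n) ⟩
    r / d + n * d / d  ≡⟨ cong₂ _+_ (m<n⇒m/n≡0 r<d) (m*n/n≡m n d) ⟩
    n                  ∎

  -[1+n]%ℕd≡d∸[1+n] : ∀ {n} → suc n < d → -[1+ n ] %ℕ d ≡ d ∸ suc n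
  -[1+n]%ℕd≡d∸[1+n] {n} 1+n<d with suc n % d | m<n⇒m%n≡m 1+n<d
  ... | .(suc n) | refl = refl

  residue<d : ∀ x → residue d x < d
  residue<d x = n%ℕd<d x d

  residue-≤ : ∀ {j c} → c ≤ j → j < d → residue d (+ j - + c) ≡ j ∸ c
  residue-≤ {j} {c} c≤j j<d = begin
    (+ j - + c) %ℕ d  ≡⟨ cong (_%ℕ d) (trans ([+m]-[+n]≡m⊖n j c) (⊖-≥ c≤j)) ⟩
    (j ∸ c) % d       ≡⟨ m<n⇒m%n≡m (≤-<-trans (m∸n≤m j c) j<d) ⟩
    j ∸ c             ∎

  residue-> : ∀ {j c} → j < c → c < d → residue d (+ j - + c) ≡ d + j ∸ c
  residue-> {j} j<c c<d with m≤n⇒∃[o]m+o≡n j<c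
  ... | k , refl = begin
    (+ j - + suc (j + k)) %ℕ d  ≡⟨ cong (_%ℕ d) (trans ([+m]-[+n]≡m⊖n j (suc (j + k))) j⊖[j+1+k]) ⟩
    -[1+ k ] %ℕ d               ≡⟨ -[1+n]%ℕd≡d∸[1+n] (≤-<-trans (s≤s (m≤n+m k j)) c<d) ⟩
    d ∸ suc k                   ≡⟨ [m+n]∸[m+o]≡n∸o j d (suc k) ⟨
    j + d ∸ (j + suc k)         ≡⟨ cong₂ _∸_ (+-comm j d) (+-suc j k) ⟩
    d + j ∸ suc (j + k)         ∎
    where
    j⊖[j+1+k] : j ⊖ suc (j + k) ≡ -[1+ k ]
    j⊖[j+1+k] = trans (cong₂ _⊖_ (sym (+-identityʳ j)) (sym (+-suc j k)))
                      (+-cancelˡ-⊖ j 0 (suc k))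

  residue-+-% : ∀ {j c} → j < d → c < d → (residue d (+ j - + c) + c) % d ≡ j
  residue-+-% {j} {c} j<d c<d with ≤-<-connex c j
  ... | inj₁ c≤j = begin
    (residue d (+ j - + c) + c) % d  ≡⟨ cong (λ r → (r + c) % d) (residue-≤ c≤j j<d) ⟩
    (j ∸ c + c) % d                  ≡⟨ cong (_% d) (m∸n+n≡m c≤j) ⟩
    j % d                            ≡⟨ m<n⇒m%n≡m j<d ⟩
    j                                ∎
  ... | inj₂ j<c = begin
    (residue d (+ j - + c) + c) % d  ≡⟨ cong (λ r → (r + c) % d) (residue-> j<c c<d) ⟩
    (d + j ∸ c + c) % d              ≡⟨ cong (_% d) (m∸n+n≡m (≤-trans (<⇒≤ c<d) (m≤m+n d j))) ⟩
    (d + j) % d                      ≡⟨ cong (_% d) (+-comm d j) ⟩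
    (j + d) % d                      ≡⟨ [m+n]%n≡m%n j d ⟩
    j % d                            ≡⟨ m<n⇒m%n≡m j<d ⟩
    j                                ∎

  residue-unique : ∀ {j c r} → j < d → c < d → r < d → (r + c) % d ≡ j →
                   r ≡ residue d (+ j - + c)
  residue-unique {j} {c} {r} j<d c<d r<d eq = begin
    r                                ≡⟨ m<n⇒m%n≡m r<d ⟨
    r % d                            ≡⟨ %-+-cancelʳ c (<⇒≤ c<d) (trans eq (sym (residue-+-% j<d c<d))) ⟩
    residue d (+ j - + c) % d        ≡⟨ m<n⇒m%n≡m (residue<d (+ j - + c)) ⟩
    residue d (+ j - + c)            ∎

  t<d : ∀ n → t d n < d
  t<d n = m%n<n (s d n) d

  countBelow-hit : ∀ {j} m → t d m ≡ j → countBelow d j (suc m) ≡ suc (countBelow d j m)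
  countBelow-hit {j} m eq =
    cong (λ b → (if b then 1 else 0) + countBelow d j m) (dec-true (t d m ℕ.≟ j) eq)

  countBelow-miss : ∀ {j} m → ¬ t d m ≡ j → countBelow d j (suc m) ≡ countBelow d j m
  countBelow-miss {j} m neq =
    cong (λ b → (if b then 1 else 0) + countBelow d j m) (dec-false (t d m ℕ.≟ j) neq)

module _ {d : ℕ} .{{_ : NonZero d}} (1<d : 1 < d) where

  digitSumFuel-zero : ∀ f → digitSumFuel d f 0 ≡ 0
  digitSumFuel-zero zero    = refl
  digitSumFuel-zero (suc f) = refl

  -- Each step divides a positive argument by d ≥ 2, so fuel m already suffices for m.
  digitSumFuel-stable : ∀ {f g} m → m ≤ f → m ≤ g → digitSumFuel d f m ≡ digitSumFuel d g m
  digitSumFuel-stable {f} {g} zero _ _ = trans (digitSumFuel-zero f) (sym (digitSumFuel-zero g))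
  digitSumFuel-stable {suc f} {suc g} m@(suc _) m≤1+f m≤1+g =
    cong (_+_ (m % d)) (digitSumFuel-stable (m / d) (m/d≤ m≤1+f) (m/d≤ m≤1+g))
    where
    m/d≤ : ∀ {h} → m ≤ suc h → m / d ≤ h
    m/d≤ m≤1+h = s≤s⁻¹ (≤-trans (m/n<m m d 1<d) m≤1+h)

  s-step : ∀ m → s d m ≡ m % d + s d (m / d)
  s-step zero = sym (cong₂ _+_ (m<n⇒m%n≡m (<-trans z<s 1<d)) (cong (s d) (0/n≡0 d)))
  s-step m@(suc _) =
    cong (_+_ (m % d)) (digitSumFuel-stable (m / d) (s≤s⁻¹ (m/n<m m d 1<d)) ≤-refl)

  s-block : ∀ n {r} → r < d → s d (d * n + r) ≡ r + s d n
  s-block n r<d = trans (s-step (d * n + _))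
    (cong₂ _+_ ([d*n+r]%d≡r n r<d) (cong (s d) ([d*n+r]/d≡n n r<d)))

  t-block : ∀ n {r} → r < d → t d (d * n + r) ≡ (r + t d n) % d
  t-block n {r} r<d = begin
    s d (d * n + r) % d    ≡⟨ cong (_% d) (s-block n r<d) ⟩
    (r + s d n) % d        ≡⟨ cong (_% d) (+-comm r (s d n)) ⟩
    (s d n + r) % d        ≡⟨ [m%d+n]%d≡[m+n]%d (s d n) r ⟨
    (t d n + r) % d        ≡⟨ cong (_% d) (+-comm (t d n) r) ⟩
    (r + t d n) % d        ∎

module Enumeration {d : ℕ} .{{_ : NonZero d}} (1<d : 1 < d) {j : ℕ} (j<d : j < d) where

  offset : ℕ → ℕ
  offset n = residue d (+ j - + t d n)

  offset<d : ∀ n → offset n < d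
  offset<d n = residue<d (+ j - + t d n)

  t-offset : ∀ n → t d (d * n + offset n) ≡ j
  t-offset n = trans (t-block 1<d n (offset<d n)) (residue-+-% j<d (t<d n))

  t≡j⇒offset : ∀ n {r} → r < d → t d (d * n + r) ≡ j → r ≡ offset n
  t≡j⇒offset n r<d eq = residue-unique j<d (t<d n) r<d (trans (sym (t-block 1<d n r<d)) eq)

  countBelow-≤offset : ∀ n r → r ≤ offset n → countBelow d j (d * n + r) ≡ countBelow d j (d * n)
  countBelow-≤offset n zero    _ = cong (countBelow d j) (+-identityʳ (d * n))
  countBelow-≤offset n (suc r) r<offset = begin
    countBelow d j (d * n + suc r)    ≡⟨ cong (countBelow d j) (+-suc (d * n) r) ⟩
    countBelow d j (suc (d * n + r))  ≡⟨ countBelow-miss (d * n + r) (λ eq → <-irrefl (t≡j⇒offset n r<d eq) r<offset) ⟩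
    countBelow d j (d * n + r)        ≡⟨ countBelow-≤offset n r (<⇒≤ r<offset) ⟩
    countBelow d j (d * n)            ∎
    where
    r<d : r < d
    r<d = <-trans r<offset (offset<d n)

  countBelow->offset : ∀ n r → offset n < r → r ≤ d →
                       countBelow d j (d * n + r) ≡ suc (countBelow d j (d * n))
  countBelow->offset n (suc r) offset<1+r 1+r≤d
    rewrite +-suc (d * n) r with m≤n⇒m<n∨m≡n (s≤s⁻¹ offset<1+r)
  ... | inj₁ offset<r = begin
    countBelow d j (suc (d * n + r))  ≡⟨ countBelow-miss (d * n + r) (λ eq → <-irrefl (sym (t≡j⇒offset n 1+r≤d eq)) offset<r) ⟩
    countBelow d j (d * n + r)        ≡⟨ countBelow->offset n r offset<r (<⇒≤ 1+r≤d) ⟩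
    suc (countBelow d j (d * n))      ∎
  ... | inj₂ refl = begin
    countBelow d j (suc (d * n + offset n))  ≡⟨ countBelow-hit (d * n + offset n) (t-offset n) ⟩
    suc (countBelow d j (d * n + offset n))  ≡⟨ cong suc (countBelow-≤offset n (offset n) ≤-refl) ⟩
    suc (countBelow d j (d * n))             ∎

  countBelow-d* : ∀ n → countBelow d j (d * n) ≡ n
  countBelow-d* zero = cong (countBelow d j) (*-zeroʳ d)
  countBelow-d* (suc n) = begin
    countBelow d j (d * suc n)      ≡⟨ cong (countBelow d j) (trans (*-suc d n) (+-comm d (d * n))) ⟩
    countBelow d j (d * n + d)      ≡⟨ countBelow->offset n d (offset<d n) ≤-refl ⟩
    suc (countBelow d j (d * n))    ≡⟨ cong suc (countBelow-d* n) ⟩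
    suc n                           ∎

  isEnum-offset : ∀ n → IsEnum d j n (d * n + offset n)
  isEnum-offset n = t-offset n , trans (countBelow-≤offset n (offset n) ≤-refl) (countBelow-d* n)

  -- With c = t_d(n) and a = t_d(dn + d - 1 - j) ≡ d - 1 - j + c, the digit d - 1 - a satisfies
  -- (d - 1 - a) + c ≡ j, so by uniqueness of residues it is the offset.
  offset-reflect : ∀ n → offset n ≡ d ∸ suc (t d (d * n + (d ∸ suc j)))
  offset-reflect n = sym (residue-unique j<d (t<d n) a′<d
    (trans (%-+-cancelʳ j′ (<⇒≤ j′<d) a′+c+j′≡j+j′) (m<n⇒m%n≡m j<d)))
    where
    c = t d n
    j′ = d ∸ suc j
    j′<d : j′ < d
    j′<d = ∸-monoʳ-< z<s j<d
    a = t d (d * n + j′)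
    a<d : a < d
    a<d = t<d (d * n + j′)
    a′ = d ∸ suc a
    a′<d : a′ < d
    a′<d = ∸-monoʳ-< z<s a<d
    a′+c+j′≡j+j′ : (a′ + c + j′) % d ≡ (j + j′) % d
    a′+c+j′≡j+j′ = begin
      (a′ + c + j′) % d          ≡⟨ cong (_% d) (trans (+-comm (a′ + c) j′)
                                      (trans (cong (_+_ j′) (+-comm a′ c)) (sym (+-assoc j′ c a′)))) ⟩
      (j′ + c + a′) % d          ≡⟨ [m%d+n]%d≡[m+n]%d (j′ + c) a′ ⟨
      ((j′ + c) % d + a′) % d    ≡⟨ cong (λ x → (x + a′) % d) (sym (t-block 1<d n j′<d)) ⟩
      (a + a′) % d               ≡⟨ cong (_% d) (suc-injective (trans (m+[n∸m]≡n a<d) (sym (m+[n∸m]≡n j<d)))) ⟩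
      (j + j′) % d               ∎

  offset-≤ : ∀ n → t d n ≤ j → offset n ≡ j ∸ t d n
  offset-≤ n t≤j = residue-≤ t≤j j<d

  offset-> : ∀ n → j + 1 ≤ t d n → offset n ≡ d + j ∸ t d n
  offset-> n j+1≤t = residue-> (subst (_≤ t d n) (+-comm j 1) j+1≤t) (t<d n)

  d*n+offset≡d*n+d∸1∸t : ∀ n → d * n + offset n ≡ d * n + d ∸ 1 ∸ t d (d * n + d ∸ j ∸ 1)
  d*n+offset≡d*n+d∸1∸t n = begin
    d * n + offset n            ≡⟨ cong (_+_ (d * n)) (offset-reflect n) ⟩
    d * n + (d ∸ suc a)         ≡⟨ +-∸-assoc (d * n) (t<d (d * n + (d ∸ suc j))) ⟨
    d * n + d ∸ suc a           ≡⟨ ∸-+-assoc (d * n + d) 1 a ⟨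
    d * n + d ∸ 1 ∸ a           ≡⟨ cong (λ x → d * n + d ∸ 1 ∸ t d x) digit ⟨
    d * n + d ∸ 1 ∸ t d (d * n + d ∸ j ∸ 1) ∎
    where
    a = t d (d * n + (d ∸ suc j))
    digit : d * n + d ∸ j ∸ 1 ≡ d * n + (d ∸ suc j)
    digit = trans (∸-+-assoc (d * n + d) j 1)
              (trans (cong (d * n + d ∸_) (+-comm j 1)) (+-∸-assoc (d * n) j<d))

proposition2p3 : (d : ℕ) .{{_ : NonZero d}} → 2 ≤ d → (j : ℕ) → j < d → (n : ℕ) →
    IsEnum d j n (d * n + residue d (+ j - + (t d n)))
    × ((t d n ≤ j → d * n + residue d (+ j - + (t d n)) ≡ d * n + (j ∸ t d n))
      × (j + 1 ≤ t d n → d * n + residue d (+ j - + (t d n)) ≡ d * n + (d + j ∸ t d n))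
      × (d * n + residue d (+ j - + (t d n)) ≡ d * n + d ∸ 1 ∸ t d (d * n + d ∸ j ∸ 1)))
proposition2p3 d 2≤d j j<d n =
    isEnum-offset n
  , (λ t≤j → cong (_+_ (d * n)) (offset-≤ n t≤j))
  , (λ j<t → cong (_+_ (d * n)) (offset-> n j<t))
  , d*n+offset≡d*n+d∸1∸t n
  where open Enumeration 2≤d j<d
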